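{- For every finite simple graph $G$, the following statements are equivalent: (1) $G$ is domishold; (2) the closed neighborhood hypergraph $\mathcal{N}(G)$ is $1$-Sperner; (3) the closed neighborhood hypergraph $\mathcal{N}(G)$ is threshold; (4) the closed neighborhood hypergraph $\mathcal{N}(G)$ is $2$-asummable.
   Context: A hypergraph $\mathcal{H}=(V,E)$ consists of a finite vertex set $V$ and a set $E$ of subsets of $V$ (hyperedges). $\mathcal{H}$ is $1$-Sperner if every two distinct hyperedges $e,f$ satisfy $\min\{|e\setminus f|,|f\setminus e|\}=1$. A set $X\subseteq V$ is independent in $\mathcal{H}$ if it contains no hyperedge, and dependent otherwise. $\mathcal{H}$ is threshold if there exist $w:V\to\mathbb{Z}_{\ge0}$ and $t\in\mathbb{Z}_{\ge0}$ such that for every $X\subseteq V$, $\sum_{x\in X}w(x)\ge t$ if and only if $X$ contains some hyperedge. $\mathcal{H}$ is $2$-asummable if there are no (not necessarily distinct) independent sets $A_1,A_2$ and dependent sets $B_1,B_2$ with $\chi^{A_1}+\chi^{A_2}=\chi^{B_1}+\chi^{B_2}$, where $\chi^S$ is the characteristic vector of $S$. A dominating set of a graph $G$ is a set $D\subseteq V(G)$ such that every vertex is in $D$ or has a neighbor in $D$. $G=(V,E)$ is domishold if there exist $w:V\to\mathbb{Z}_{\ge0}$ and $t\in\mathbb{Z}_{\ge0}$ such that for every $X\subseteq V$, $\sum_{x\in X}w(x)\ge t$ if and only if $X$ is a dominating set. $N[v]$ denotes the closed neighborhood of $v$ ($v$ together with its neighbors). The closed neighborhood hypergraph $\mathcal{N}(G)$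 has vertex set $V(G)$ and as hyperedges exactly the inclusion-minimal sets among $\{N[v]: v\in V(G)\}$. -}

module Defs where

open import Data.Nat using (ℕ; zero; suc; _+_; _≤_; _⊓_)
open import Data.Bool using (Bool; true; false; if_then_else_; _∨_)
open import Data.Fin using (Fin; _≟_)
open import Data.Fin.Subset using (Subset; _∈_; _⊆_; _⊂_; _─_; ∣_∣; inside)
open import Data.Vec using (tabulate; lookup)
open import Data.List using (map; allFin)
open import Data.Nat.ListAction using (sum)
open import Data.Product using (Σ; ∃; _×_; _,_)
open import Data.Sum using (_⊎_)
open import Relation.Nullary using (¬_; does)
open import Relation.Binary.PropositionalEquality using (_≡_; _≢_)
open import Function.Bundles using (_⇔_)

record Graph (n : ℕ) : Set where
  field
    adj    : Fin n → Fin n → Bool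
    sym    : ∀ i j → adj i j ≡ adj j i
    irrefl : ∀ i → adj i i ≡ false
open Graph public

N[_]_ : ∀ {n} → Fin n → Graph n → Subset n
N[ v ] G = tabulate (λ u → does (u ≟ v) ∨ adj G v u)

Dominating : ∀ {n} → Graph n → Subset n → Set
Dominating {n} G D = ∀ (v : Fin n) → v ∈ D ⊎ (∃ λ u → adj G v u ≡ true × u ∈ D)

wsum : ∀ {n} → (Fin n → ℕ) → Subset n → ℕ
wsum {n} w X = sum (map (λ i → if lookup X i then w i else 0) (allFin n))

Domishold : ∀ {n} → Graph n → Set
Domishold {n} G = Σ (Fin n → ℕ) λ w → Σ ℕ λ t →
  ∀ (X : Subset n) → (t ≤ wsum w X) ⇔ Dominating G X

record Hypergraph (n : ℕ) : Set₁ where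
  field
    Edge : Subset n → Set
open Hypergraph public

OneSperner : ∀ {n} → Hypergraph n → Set
OneSperner H = ∀ e f → Edge H e → Edge H f → e ≢ f →
  (∣ e ─ f ∣ ⊓ ∣ f ─ e ∣) ≡ 1

Dependent : ∀ {n} → Hypergraph n → Subset n → Set
Dependent H X = ∃ λ e → Edge H e × e ⊆ X

Independent : ∀ {n} → Hypergraph n → Subset n → Set
Independent H X = ¬ Dependent H X

Threshold : ∀ {n} → Hypergraph n → Set
Threshold {n} H = Σ (Fin n → ℕ) λ w → Σ ℕ λ t →
  ∀ (X : Subset n) → (t ≤ wsum w X) ⇔ Dependent H X

χ : ∀ {n} → Subset n → Fin n → ℕ
χ X i = if lookup X i then 1 else 0

TwoAsummable : ∀ {n} → Hypergraph n → Set
TwoAsummable {n} H = ¬ (Σ (Subset n) λ A₁ → Σ (Subset n) λ A₂ →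
  Σ (Subset n) λ B₁ → Σ (Subset n) λ B₂ →
  Independent H A₁ × Independent H A₂ × Dependent H B₁ × Dependent H B₂ ×
  (∀ i → χ A₁ i + χ A₂ i ≡ χ B₁ i + χ B₂ i))

ClosedNbhdHypergraph : ∀ {n} → Graph n → Hypergraph n
ClosedNbhdHypergraph {n} G = record
  { Edge = λ S → (∃ λ (v : Fin n) → S ≡ N[ v ] G) ×
                 (∀ (u : Fin n) → ¬ (N[ u ] G ⊂ S)) }

module Submission where

-- (1) ⇔ (3) is complementation duality: X dominates G iff its complement
-- contains no closed neighbourhood, and a property Q with Q X ⇔ ¬ P (∁ X) is
-- threshold whenever P is (same weights, threshold Σw + 1 ∸ t).
-- (3) ⇒ (4) holds for every hypergraph.
-- (4) ⇒ (2): two distinct minimal closed neighbourhoods N[u], N[v] each have a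
-- private vertex; if both had two, a suitable exchange of private vertices
-- between N[u] and N[v] would produce two independent sets with the same
-- characteristic-vector sum as the dependent sets N[u], N[v].
-- (2) ⇒ (3) holds for every 1-Sperner hypergraph (given by a list of edges):
-- such a family has a splitting vertex z, at which it decomposes into two
-- 1-Sperner families of smaller support whose threshold representations can
-- be glued together (well-founded induction on the support).

open import Defs hiding (sym)
open import Data.Nat using (ℕ; zero; suc; _+_; _*_; _∸_; _⊓_; _≤_; _<_; _≤?_; z≤n; s≤s)
import Data.Nat.Properties as ℕ
open import Data.Nat.ListAction using () renaming (sum to listSum)
open import Data.Bool using (true; false; if_then_else_; not; _∧_; _∨_)
open import Data.Bool.Properties using () renaming (_≟_ to _≟ᵇ_)
open import Data.Fin using (Fin; zero; suc; _≟_)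
import Data.Fin.Properties as Fin
open import Data.Fin.Subset
  using (Subset; _∈_; _∉_; _⊆_; _⊂_; ∁; _∪_; _∩_; _─_; _-_; ⁅_⁆; ⋃; ∣_∣; Nonempty)
open import Data.Fin.Subset.Properties
  using (_∈?_; _⊆?_; _⊂?_; nonempty?; ⊆-trans; ⊆-antisym; p⊂q⇒p⊆q; p⊆q⇒∣p∣≤∣q∣;
         x∈p⇒x∉∁p; x∈∁p⇒x∉p; x∉∁p⇒x∈p; x∉p⇒x∈∁p; x∈p∪q⁻; x∈p∪q⁺; ∉⊥; x∈p∩q⁺; x∈p∩q⁻; ∩-comm;
         x∈⁅x⁆; x∈⁅y⁆⇒x≡y; x∉⁅y⁆⇒x≢y; ∣⁅x⁆∣≡1; p─q⊆p; x∈p∧x∉q⇒x∈p─q; x∈p∧x≢y⇒x∈p-y; x∈p⇒∣p-x∣<∣p∣)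
open import Data.Fin.Subset.Induction using (Acc; acc; ⊂-wellFounded)
open import Data.Vec using ([]; _∷_; here; there; lookup)
open import Data.Vec.Properties using (≡-dec; []=⇒lookup; lookup⇒[]=; lookup-map; lookup-zipWith; lookup∘tabulate)
open import Data.List using (List; []; _∷_; map; filter; allFin; tabulate)
open import Data.List.Properties using (map-tabulate)
open import Data.List.Relation.Unary.Any as Any using (here; there)
import Data.List.Relation.Unary.All as All
open import Data.List.Membership.Propositional using (find; lose) renaming (_∈_ to _∈ₗ_)
open import Data.List.Membership.Propositional.Properties using (∈-map∘filter⁻; ∈-map∘filter⁺; ∈-allFin)
open import Data.List.Extrema ℕ.≤-totalOrder
  using (argmin; argmax; argmin-sel; argmax-sel; f[argmin]≤f[xs]; f[xs]≤f[argmax])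
open import Data.Product using (Σ; ∃; _×_; _,_; proj₁; proj₂)
open import Data.Sum using (_⊎_; inj₁; inj₂; [_,_]′)
open import Data.Empty using (⊥; ⊥-elim)
open import Relation.Nullary using (¬_; Dec; yes; no; does; _×-dec_)
import Relation.Nullary.Decidable as Dec
open import Relation.Unary using (Decidable)
open import Relation.Binary using (tri<; tri≈; tri>)
open import Relation.Binary.PropositionalEquality
open import Function.Base using (_∘_; id)
open import Function.Bundles using (_⇔_; mk⇔; module Equivalence)
open import Algebra.Properties.Semiring.Sum ℕ.+-*-semiring
  using (sum; sum-cong-≗; sum-replicate-zero; ∑-distrib-+; *-distribˡ-sum)

open Equivalence using (to; from)

x∈p─q⇒x∉q : ∀ {n} {x : Fin n} (p q : Subset n) → x ∈ p ─ q → x ∉ q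
x∈p─q⇒x∉q (true ∷ p) (false ∷ q) here ()
x∈p─q⇒x∉q (_ ∷ p) (_ ∷ q) (there x∈) (there x∈q) = x∈p─q⇒x∉q p q x∈ x∈q

∈⇒1≤∣p∣ : ∀ {n} {x : Fin n} {p : Subset n} → x ∈ p → 1 ≤ ∣ p ∣
∈⇒1≤∣p∣ {x = x} x∈p = subst (_≤ _) (∣⁅x⁆∣≡1 x) (p⊆q⇒∣p∣≤∣q∣ λ y∈ → subst (_∈ _) (sym (x∈⁅y⁆⇒x≡y x y∈)) x∈p)

1≤∣p∣⇒nonempty : ∀ {n} (p : Subset n) → 1 ≤ ∣ p ∣ → Nonempty p
1≤∣p∣⇒nonempty (true  ∷ p) _   = zero , here
1≤∣p∣⇒nonempty (false ∷ p) 1≤∣p∣ with 1≤∣p∣⇒nonempty p 1≤∣p∣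
... | x , x∈p = suc x , there x∈p

2≤∣p∣⇒avoid : ∀ {n} (p : Subset n) → 2 ≤ ∣ p ∣ → ∀ a → ∃ λ x → x ∈ p × x ≢ a
2≤∣p∣⇒avoid (true ∷ p) (s≤s 1≤∣p∣) zero with 1≤∣p∣⇒nonempty p 1≤∣p∣
... | x , x∈p = suc x , there x∈p , λ ()
2≤∣p∣⇒avoid (true ∷ p) _ (suc a) = zero , here , λ ()
2≤∣p∣⇒avoid (false ∷ p) 2≤∣p∣ zero with 1≤∣p∣⇒nonempty p (ℕ.≤-trans (s≤s z≤n) 2≤∣p∣)
... | x , x∈p = suc x , there x∈p , λ ()
2≤∣p∣⇒avoid (false ∷ p) 2≤∣p∣ (suc a) with 2≤∣p∣⇒avoid p 2≤∣p∣ a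
... | x , x∈p , x≢a = suc x , there x∈p , x≢a ∘ Fin.suc-injective

∣p∣≤1⇒unique : ∀ {n} {x y : Fin n} {p : Subset n} → ∣ p ∣ ≤ 1 → x ∈ p → y ∈ p → x ≡ y
∣p∣≤1⇒unique {x = x} {y} {p} ∣p∣≤1 x∈p y∈p with x ≟ y
... | yes x≡y = x≡y
... | no  x≢y = ⊥-elim (ℕ.<-irrefl refl (ℕ.≤-trans (x∈p⇒∣p-x∣<∣p∣ x∈p) (ℕ.≤-trans ∣p∣≤1 y∈p-x)))
  where y∈p-x : 1 ≤ ∣ p - x ∣
        y∈p-x = ∈⇒1≤∣p∣ (x∈p∧x≢y⇒x∈p-y y∈p (x≢y ∘ sym))

∣p─q∣+∣p∩q∣ : ∀ {n} (p q : Subset n) → ∣ p ─ q ∣ + ∣ p ∩ q ∣ ≡ ∣ p ∣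
∣p─q∣+∣p∩q∣ []          []          = refl
∣p─q∣+∣p∩q∣ (true  ∷ p) (true  ∷ q) = trans (ℕ.+-suc _ _) (cong suc (∣p─q∣+∣p∩q∣ p q))
∣p─q∣+∣p∩q∣ (true  ∷ p) (false ∷ q) = cong suc (∣p─q∣+∣p∩q∣ p q)
∣p─q∣+∣p∩q∣ (false ∷ p) (true  ∷ q) = ∣p─q∣+∣p∩q∣ p q
∣p─q∣+∣p∩q∣ (false ∷ p) (false ∷ q) = ∣p─q∣+∣p∩q∣ p q

∣p∣≤∣q∣⇒∣p─q∣≤∣q─p∣ : ∀ {n} (p q : Subset n) → ∣ p ∣ ≤ ∣ q ∣ → ∣ p ─ q ∣ ≤ ∣ q ─ p ∣
∣p∣≤∣q∣⇒∣p─q∣≤∣q─p∣ p q ∣p∣≤∣q∣ = ℕ.+-cancelʳ-≤ ∣ p ∩ q ∣ _ _ (subst₂ _≤_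
  (sym (∣p─q∣+∣p∩q∣ p q))
  (trans (sym (∣p─q∣+∣p∩q∣ q p)) (cong (λ r → ∣ q ─ p ∣ + ∣ r ∣) (∩-comm q p)))
  ∣p∣≤∣q∣)

⊈⇒∃ : ∀ {n} {p q : Subset n} → ¬ (p ⊆ q) → ∃ λ x → x ∈ p × x ∉ q
⊈⇒∃ {p = p} {q} p⊈q with Fin.any? (λ x → (x ∈? p) ×-dec Dec.¬? (x ∈? q))
... | yes found = found
... | no  none  = ⊥-elim (p⊈q λ {x} x∈p → Dec.decidable-stable (x ∈? q) λ x∉q → none (x , x∈p , x∉q))

x∈p─q⇔ : ∀ {n} {x : Fin n} {p q : Subset n} → x ∈ p ─ q ⇔ (x ∈ p × x ∉ q)
x∈p─q⇔ {p = p} {q} = mk⇔ (λ x∈ → p─q⊆p p q x∈ , x∈p─q⇒x∉q p q x∈) (λ (x∈p , x∉q) → x∈p∧x∉q⇒x∈p─q x∈p x∉q)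

swap : ∀ {n} → Subset n → Fin n → Fin n → Subset n
swap S x y = (S - x) ∪ ⁅ y ⁆

∈swap⁻ : ∀ {n} {S : Subset n} {x y i} → i ∈ swap S x y → (i ∈ S × i ≢ x) ⊎ i ≡ y
∈swap⁻ {S = S} {x} {y} i∈ with x∈p∪q⁻ (S - x) ⁅ y ⁆ i∈
... | inj₂ i∈⁅y⁆ = inj₂ (x∈⁅y⁆⇒x≡y y i∈⁅y⁆)
... | inj₁ i∈S-x = inj₁ (to x∈p─q⇔ i∈S-x .proj₁ , x∉⁅y⁆⇒x≢y (to x∈p─q⇔ i∈S-x .proj₂))

∈swap⁺ : ∀ {n} {S : Subset n} {x y i} → (i ∈ S × i ≢ x) ⊎ i ≡ y → i ∈ swap S x y
∈swap⁺ (inj₁ (i∈S , i≢x)) = x∈p∪q⁺ (inj₁ (x∈p∧x≢y⇒x∈p-y i∈S i≢x))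
∈swap⁺ {y = y} (inj₂ refl) = x∈p∪q⁺ (inj₂ (x∈⁅x⁆ y))

x∉swap : ∀ {n} {S : Subset n} {x y} → x ∈ S → y ∉ S → x ∉ swap S x y
x∉swap x∈S y∉S x∈ with ∈swap⁻ x∈
... | inj₁ (_ , x≢x) = x≢x refl
... | inj₂ refl      = y∉S x∈S

χ-∈ : ∀ {n} {S : Subset n} {i} → i ∈ S → χ S i ≡ 1
χ-∈ i∈S rewrite []=⇒lookup i∈S = refl

χ-∉ : ∀ {n} {S : Subset n} {i} → i ∉ S → χ S i ≡ 0
χ-∉ {S = S} {i} i∉S with lookup S i in eq
... | true  = ⊥-elim (i∉S (lookup⇒[]= i S eq))
... | false = refl

χ-swap : ∀ {n} {P Q : Subset n} {x y} → x ∈ P → x ∉ Q → y ∈ Q → y ∉ P →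
  ∀ i → χ (swap P x y) i + χ (swap Q y x) i ≡ χ P i + χ Q i
χ-swap {P = P} {Q} {x} {y} x∈P x∉Q y∈Q y∉P i with i ≟ x | i ≟ y
... | yes refl | _        = trans (cong₂ _+_ (χ-∉ (x∉swap x∈P y∉P)) (χ-∈ (∈swap⁺ {S = Q} (inj₂ refl))))
                                  (sym (cong₂ _+_ (χ-∈ x∈P) (χ-∉ x∉Q)))
... | no _     | yes refl = trans (cong₂ _+_ (χ-∈ (∈swap⁺ {S = P} (inj₂ refl))) (χ-∉ (x∉swap y∈Q x∉Q)))
                                  (sym (cong₂ _+_ (χ-∉ y∉P) (χ-∈ y∈Q)))
... | no i≢x   | no i≢y   = cong₂ _+_ (unchanged P i≢x i≢y) (unchanged Q i≢y i≢x)
  where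
  unchanged : ∀ S {a b} → i ≢ a → i ≢ b → χ (swap S a b) i ≡ χ S i
  unchanged S i≢a i≢b with i ∈? S
  ... | yes i∈S = trans (χ-∈ (∈swap⁺ {S = S} (inj₁ (i∈S , i≢a)))) (sym (χ-∈ i∈S))
  ... | no  i∉S = trans (χ-∉ {S = swap S _ _} λ i∈ → [ i∉S ∘ proj₁ , i≢b ]′ (∈swap⁻ {S = S} i∈)) (sym (χ-∉ i∉S))

restrict : ∀ {n} → Subset n → (Fin n → ℕ) → Fin n → ℕ
restrict X w i = if lookup X i then w i else 0

restrict-∈ : ∀ {n} {X : Subset n} {i} (w : Fin n → ℕ) → i ∈ X → restrict X w i ≡ w i
restrict-∈ w i∈X rewrite []=⇒lookup i∈X = refl

restrict-∉ : ∀ {n} {X : Subset n} {i} (w : Fin n → ℕ) → i ∉ X → restrict X w i ≡ 0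
restrict-∉ {X = X} {i} w i∉X with lookup X i in eq
... | true  = ⊥-elim (i∉X (lookup⇒[]= i X eq))
... | false = refl

wsum≡sum : ∀ {n} (w : Fin n → ℕ) X → wsum w X ≡ sum (restrict X w)
wsum≡sum w X = listSum-allFin (restrict X w)
  where
  listSum-allFin : ∀ {n} (f : Fin n → ℕ) → listSum (map f (allFin n)) ≡ sum f
  listSum-allFin {zero}  f = refl
  listSum-allFin {suc n} f = cong (f zero +_) (begin
    listSum (map f (tabulate suc))      ≡⟨ cong listSum (map-tabulate suc f) ⟩
    listSum (tabulate (f ∘ suc))        ≡⟨ cong listSum (map-tabulate id (f ∘ suc)) ⟨
    listSum (map (f ∘ suc) (allFin n))  ≡⟨ listSum-allFin (f ∘ suc) ⟩
    sum (f ∘ suc)                       ∎)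
    where open ≡-Reasoning

sum-mono : ∀ {n} {f g : Fin n → ℕ} → (∀ i → f i ≤ g i) → sum f ≤ sum g
sum-mono {zero}  f≤g = z≤n
sum-mono {suc n} f≤g = ℕ.+-mono-≤ (f≤g zero) (sum-mono (f≤g ∘ suc))

point : ∀ {n} → Fin n → ℕ → Fin n → ℕ
point z m i = if does (i ≟ z) then m else 0

sum-point : ∀ {n} (z : Fin n) m → sum (point z m) ≡ m
sum-point {suc n} zero    m = trans (cong (m +_) (sum-replicate-zero n)) (ℕ.+-identityʳ m)
sum-point {suc n} (suc z) m = sum-point z m

wsum-point : ∀ {n} (z : Fin n) m X → wsum (point z m) X ≡ restrict X (λ _ → m) z
wsum-point z m X = trans (wsum≡sum (point z m) X)
  (trans (sum-cong-≗ restrict-point) (sum-point z (restrict X (λ _ → m) z)))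
  where
  restrict-point : ∀ i → restrict X (point z m) i ≡ point z (restrict X (λ _ → m) z) i
  restrict-point i with i ≟ z
  ... | yes refl = refl
  ... | no  _    with lookup X i
  ...   | true  = refl
  ...   | false = refl

restrict≤ : ∀ {n} (X : Subset n) (w : Fin n → ℕ) i → restrict X w i ≤ w i
restrict≤ X w i with lookup X i
... | true  = ℕ.≤-refl
... | false = z≤n

wsum≤sum : ∀ {n} (w : Fin n → ℕ) X → wsum w X ≤ sum w
wsum≤sum w X = subst (_≤ sum w) (sym (wsum≡sum w X)) (sum-mono (restrict≤ X w))

wsum-mono : ∀ {n} (w : Fin n → ℕ) {X Y : Subset n} → X ⊆ Y → wsum w X ≤ wsum w Y
wsum-mono w {X} {Y} X⊆Y = subst₂ _≤_ (sym (wsum≡sum w X)) (sym (wsum≡sum w Y)) (sum-mono restrict-mono)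
  where
  restrict-mono : ∀ i → restrict X w i ≤ restrict Y w i
  restrict-mono i with i ∈? X
  ... | yes i∈X = ℕ.≤-reflexive (trans (restrict-∈ w i∈X) (sym (restrict-∈ w (X⊆Y i∈X))))
  ... | no  i∉X = subst (_≤ _) (sym (restrict-∉ w i∉X)) z≤n

wsum-∁ : ∀ {n} (w : Fin n → ℕ) X → wsum w X + wsum w (∁ X) ≡ sum w
wsum-∁ w X = begin
  wsum w X + wsum w (∁ X)                              ≡⟨ cong₂ _+_ (wsum≡sum w X) (wsum≡sum w (∁ X)) ⟩
  sum (restrict X w) + sum (restrict (∁ X) w)          ≡⟨ ∑-distrib-+ (restrict X w) (restrict (∁ X) w) ⟨
  sum (λ i → restrict X w i + restrict (∁ X) w i)      ≡⟨ sum-cong-≗ split ⟩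
  sum w                                                ∎
  where
  open ≡-Reasoning
  split : ∀ i → restrict X w i + restrict (∁ X) w i ≡ w i
  split i rewrite lookup-map i not X with lookup X i
  ... | true  = ℕ.+-identityʳ (w i)
  ... | false = refl

wsum-linear : ∀ {n} a (f g : Fin n → ℕ) X → wsum (λ i → a * f i + g i) X ≡ a * wsum f X + wsum g X
wsum-linear a f g X = begin
  wsum (λ i → a * f i + g i) X                           ≡⟨ wsum≡sum _ X ⟩
  sum (restrict X (λ i → a * f i + g i))                 ≡⟨ sum-cong-≗ distribute ⟩
  sum (λ i → a * restrict X f i + restrict X g i)        ≡⟨ ∑-distrib-+ (λ i → a * restrict X f i) (restrict X g) ⟩
  sum (λ i → a * restrict X f i) + sum (restrict X g)    ≡⟨ cong (_+ _) (*-distribˡ-sum a (restrict X f)) ⟨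
  a * sum (restrict X f) + sum (restrict X g)            ≡⟨ cong₂ (λ p q → a * p + q) (wsum≡sum f X) (wsum≡sum g X) ⟨
  a * wsum f X + wsum g X                                ∎
  where
  open ≡-Reasoning
  distribute : ∀ i → restrict X (λ i → a * f i + g i) i ≡ a * restrict X f i + restrict X g i
  distribute i with lookup X i
  ... | true  = refl
  ... | false = sym (trans (ℕ.+-identityʳ (a * 0)) (ℕ.*-zeroʳ a))

wsum-restrict : ∀ {n} (V : Subset n) (w : Fin n → ℕ) X → wsum (restrict V w) X ≡ wsum w (X ∩ V)
wsum-restrict V w X = trans (wsum≡sum _ X) (trans (sum-cong-≗ restrict-∩) (sym (wsum≡sum w (X ∩ V))))
  where
  restrict-∩ : ∀ i → restrict X (restrict V w) i ≡ restrict (X ∩ V) w i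
  restrict-∩ i rewrite lookup-zipWith _∧_ i X V with lookup X i
  ... | true  = refl
  ... | false = refl

wsum-full : ∀ {n} (w : Fin n → ℕ) X → (∀ i → i ∉ X → w i ≡ 0) → wsum w X ≡ sum w
wsum-full w X outside-zero = trans (wsum≡sum w X) (sum-cong-≗ restrict-full)
  where
  restrict-full : ∀ i → restrict X w i ≡ w i
  restrict-full i with i ∈? X
  ... | yes i∈X = restrict-∈ w i∈X
  ... | no  i∉X = trans (restrict-∉ w i∉X) (sym (outside-zero i i∉X))

wsum-missing : ∀ {n} (w : Fin n → ℕ) X j → j ∉ X → 1 ≤ w j → wsum w X < sum w
wsum-missing w X j j∉X 1≤wj = begin-strict
  wsum w X                                  <⟨ ℕ.n<1+n _ ⟩
  suc (wsum w X)                            ≡⟨ trans (ℕ.+-comm 1 _) (cong₂ _+_ (wsum≡sum w X) (sym (sum-point j 1))) ⟩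
  sum (restrict X w) + sum (point j 1)      ≡⟨ ∑-distrib-+ (restrict X w) (point j 1) ⟨
  sum (λ i → restrict X w i + point j 1 i)  ≤⟨ sum-mono bounded ⟩
  sum w                                     ∎
  where
  open ℕ.≤-Reasoning
  bounded : ∀ i → restrict X w i + point j 1 i ≤ w i
  bounded i with i ≟ j
  ... | yes refl = subst (λ r → r + 1 ≤ w i) (sym (restrict-∉ w j∉X)) 1≤wj
  ... | no  _    = subst (_≤ w i) (sym (ℕ.+-identityʳ _)) (restrict≤ X w i)

wsum-χ : ∀ {n} (w : Fin n → ℕ) {A B C D : Subset n} →
  (∀ i → χ A i + χ B i ≡ χ C i + χ D i) → wsum w A + wsum w B ≡ wsum w C + wsum w D
wsum-χ w {A} {B} {C} {D} χ-eq = begin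
  wsum w A + wsum w B                      ≡⟨ pair-sum A B ⟩
  sum (λ i → (χ A i + χ B i) * w i)        ≡⟨ sum-cong-≗ (λ i → cong (_* w i) (χ-eq i)) ⟩
  sum (λ i → (χ C i + χ D i) * w i)        ≡⟨ pair-sum C D ⟨
  wsum w C + wsum w D                      ∎
  where
  open ≡-Reasoning
  pair : ∀ P Q i → restrict P w i + restrict Q w i ≡ (χ P i + χ Q i) * w i
  pair P Q i with lookup P i | lookup Q i
  ... | true  | true  = cong (w i +_) (sym (ℕ.+-identityʳ (w i)))
  ... | true  | false = refl
  ... | false | true  = sym (ℕ.+-identityʳ (w i))
  ... | false | false = refl
  pair-sum : ∀ P Q → wsum w P + wsum w Q ≡ sum (λ i → (χ P i + χ Q i) * w i)
  pair-sum P Q = trans (cong₂ _+_ (wsum≡sum w P) (wsum≡sum w Q))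
    (trans (sym (∑-distrib-+ (restrict P w) (restrict Q w))) (sum-cong-≗ (pair P Q)))

digit-bound : ∀ B a {s} → s < B → B * a + s < B * suc a
digit-bound B a s<B = ℕ.<-≤-trans (ℕ.+-monoʳ-< (B * a) s<B)
  (ℕ.≤-reflexive (trans (ℕ.+-comm (B * a) B) (sym (ℕ.*-suc B a))))

lex-≤⁻ : ∀ B {a c s t} → s < B → B * c + t ≤ B * a + s → c < a ⊎ (c ≡ a × t ≤ s)
lex-≤⁻ B {a} {c} {s} {t} s<B le with ℕ.<-cmp c a
... | tri< c<a _ _    = inj₁ c<a
... | tri≈ _ refl _   = inj₂ (refl , ℕ.+-cancelˡ-≤ (B * c) _ _ le)
... | tri> _ _ a<c    = ⊥-elim (ℕ.<-irrefl refl (begin-strict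
  B * a + s      <⟨ digit-bound B a s<B ⟩
  B * suc a      ≤⟨ ℕ.*-monoʳ-≤ B a<c ⟩
  B * c          ≤⟨ ℕ.m≤m+n (B * c) t ⟩
  B * c + t      ≤⟨ le ⟩
  B * a + s      ∎))
  where open ℕ.≤-Reasoning

lex-≤⁺ : ∀ B {a c s t} → t < B → c < a → B * c + t ≤ B * a + s
lex-≤⁺ B {a} {c} {s} {t} t<B c<a = begin
  B * c + t      ≤⟨ ℕ.<⇒≤ (digit-bound B c t<B) ⟩
  B * suc c      ≤⟨ ℕ.*-monoʳ-≤ B c<a ⟩
  B * a          ≤⟨ ℕ.m≤m+n (B * a) s ⟩
  B * a + s      ∎
  where open ℕ.≤-Reasoning

odd-above : ∀ {t k W} g → t + k ≡ W → (2 * W < 2 * g + suc (2 * k) ⇔ t ≤ g)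
odd-above {t} {k} {W} g t+k≡W = mk⇔
  (λ above → ℕ.*-cancelˡ-≤ 2 (ℕ.+-cancelʳ-≤ (2 * k) _ _ (ℕ.≤-pred (subst₂ _<_ 2W≡ odd≡ above))))
  (λ t≤g → subst₂ _<_ (sym 2W≡) (sym odd≡) (s≤s (ℕ.+-monoˡ-≤ (2 * k) (ℕ.*-monoʳ-≤ 2 t≤g))))
  where
  2W≡ : 2 * W ≡ 2 * t + 2 * k
  2W≡ = trans (cong (2 *_) (sym t+k≡W)) (ℕ.*-distribˡ-+ 2 t k)
  odd≡ : 2 * g + suc (2 * k) ≡ suc (2 * g + 2 * k)
  odd≡ = ℕ.+-suc (2 * g) (2 * k)

odd≢even : ∀ {W} g k → 2 * g + suc (2 * k) ≢ 2 * W
odd≢even {W} g k eq = ℕ.even≢odd W (g + k) (sym (begin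
  suc (2 * (g + k))      ≡⟨ cong suc (ℕ.*-distribˡ-+ 2 g k) ⟩
  suc (2 * g + 2 * k)    ≡⟨ ℕ.+-suc (2 * g) (2 * k) ⟨
  2 * g + suc (2 * k)    ≡⟨ eq ⟩
  2 * W                  ∎))
  where open ≡-Reasoning

-- Domishold G is IsThreshold (Dominating G) and
-- Threshold H is IsThreshold (Dependent H), both by definition.
IsThreshold : ∀ {n} → (Subset n → Set) → Set
IsThreshold {n} P = Σ (Fin n → ℕ) λ w → Σ ℕ λ t → ∀ X → (t ≤ wsum w X) ⇔ P X

threshold-⇔ : ∀ {n} {P Q : Subset n → Set} → (∀ X → P X ⇔ Q X) → IsThreshold P → IsThreshold Q
threshold-⇔ P⇔Q (w , t , rep) = w , t , λ X →
  mk⇔ (to (P⇔Q X) ∘ to (rep X)) (from (rep X) ∘ from (P⇔Q X))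

complement-threshold : ∀ {a b W} t → a + b ≡ W → (b < t ⇔ suc W ∸ t ≤ a)
complement-threshold {a} {b} {W} t a+b≡W = mk⇔
  (λ b<t → ℕ.m≤n+o⇒m∸n≤o (suc W) t (begin
     suc W        ≡⟨ cong suc a+b≡W ⟨
     suc (a + b)  ≡⟨ ℕ.+-suc a b ⟨
     a + suc b    ≤⟨ ℕ.+-monoʳ-≤ a b<t ⟩
     a + t        ≡⟨ ℕ.+-comm a t ⟩
     t + a        ∎))
  (λ W∸t≤a → ℕ.+-cancelˡ-≤ a _ _ (begin
     a + suc b    ≡⟨ trans (ℕ.+-suc a b) (cong suc a+b≡W) ⟩
     suc W        ≤⟨ ℕ.m≤n+m∸n (suc W) t ⟩
     t + (suc W ∸ t) ≤⟨ ℕ.+-monoʳ-≤ t W∸t≤a ⟩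
     t + a        ≡⟨ ℕ.+-comm t a ⟩
     a + t        ∎))
  where open ℕ.≤-Reasoning

threshold-dual : ∀ {n} {P Q : Subset n → Set} →
  (∀ X → Q X ⇔ (¬ P (∁ X))) → IsThreshold P → IsThreshold Q
threshold-dual Q⇔¬P∁ (w , t , rep) = w , suc (sum w) ∸ t , λ X →
  let below = complement-threshold t (wsum-∁ w X) in mk⇔
  (λ reached → from (Q⇔¬P∁ X) λ P∁X → ℕ.<⇒≱ (from below reached) (from (rep (∁ X)) P∁X))
  (λ QX → to below (ℕ.≰⇒> λ t≤ → to (Q⇔¬P∁ X) QX (to (rep (∁ X)) t≤)))

-- Threshold hypergraphs are 2-asummable: two independent sets weigh less
-- than 2t in total, two dependent sets at least 2t.
threshold⇒2-asummable : ∀ {n} (H : Hypergraph n) → Threshold H → TwoAsummable H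
threshold⇒2-asummable H (w , t , rep) (A₁ , A₂ , B₁ , B₂ , I₁ , I₂ , D₁ , D₂ , χ-eq) =
  ℕ.<-irrefl refl (begin-strict
    wsum w A₁ + wsum w A₂  <⟨ ℕ.+-mono-< (below A₁ I₁) (below A₂ I₂) ⟩
    t + t                  ≤⟨ ℕ.+-mono-≤ (from (rep B₁) D₁) (from (rep B₂) D₂) ⟩
    wsum w B₁ + wsum w B₂  ≡⟨ wsum-χ w {A₁} {A₂} {B₁} {B₂} χ-eq ⟨
    wsum w A₁ + wsum w A₂  ∎)
  where
  open ℕ.≤-Reasoning
  below : ∀ A → Independent H A → wsum w A < t
  below A I = ℕ.≰⇒> (I ∘ to (rep A))

restrict-rep : ∀ {n} {P : Subset n → Set} {V : Subset n} {w t} → (∀ X → P X ⇔ P (X ∩ V)) →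
  (∀ X → t ≤ wsum w X ⇔ P X) → ∀ X → t ≤ wsum (restrict V w) X ⇔ P X
restrict-rep {V = V} {w} local rep X = mk⇔
  (λ t≤ → from (local X) (to (rep (X ∩ V)) (subst (_ ≤_) (wsum-restrict V w X) t≤)))
  (λ PX → subst (_ ≤_) (sym (wsum-restrict V w X)) (from (rep (X ∩ V)) (to (local X) PX)))

scale-perturb : ∀ {n} {P : Subset n → Set} {w t} (c : ℕ) (h : Fin n → ℕ) →
  (∀ X → wsum h X < c) → (∀ X → t ≤ wsum w X ⇔ P X) →
  ∀ X → c * t ≤ wsum (λ i → c * w i + h i) X ⇔ P X
scale-perturb {w = w} {t} c h small rep X = mk⇔
  (λ reached → to (rep X) (ℕ.≤-pred (ℕ.*-cancelˡ-< c t (suc (wsum w X))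
     (ℕ.≤-<-trans (subst (c * t ≤_) (wsum-linear c w h X) reached) (digit-bound c (wsum w X) (small X))))))
  (λ PX → subst (c * t ≤_) (sym (wsum-linear c w h X))
     (ℕ.≤-trans (ℕ.*-monoʳ-≤ c (from (rep X) PX)) (ℕ.m≤m+n _ _)))

PositiveThreshold : ∀ {n} → Subset n → (Subset n → Set) → Set
PositiveThreshold {n} V P = Σ (Fin n → ℕ) λ g → Σ ℕ λ t →
  (∀ i → i ∉ V → g i ≡ 0) × (∀ i → i ∈ V → 1 ≤ g i) × (∀ X → t ≤ wsum g X ⇔ P X)

-- A threshold property depending only on the part inside V has such a
-- representation: restrict to V, scale up, and add weight 1 on V.
positive-threshold : ∀ {n} {P : Subset n → Set} (V : Subset n) →
  (∀ X → P X ⇔ P (X ∩ V)) → IsThreshold P → PositiveThreshold V P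
positive-threshold V local (w , t , rep) =
  g , c * t , zero-off , positive , scale-perturb c one (λ X → s≤s (wsum≤sum one X)) (restrict-rep local rep)
  where
  one = restrict V (λ _ → 1)
  c = suc (sum one)
  g = λ i → c * restrict V w i + one i
  zero-off : ∀ i → i ∉ V → g i ≡ 0
  zero-off i i∉V = trans (cong₂ (λ a b → c * a + b) (restrict-∉ w i∉V) (restrict-∉ (λ _ → 1) i∉V))
                         (trans (ℕ.+-identityʳ (c * 0)) (ℕ.*-zeroʳ c))
  positive : ∀ i → i ∈ V → 1 ≤ g i
  positive i i∈V = subst (λ b → 1 ≤ c * restrict V w i + b) (sym (restrict-∈ (λ _ → 1) i∈V)) (ℕ.m≤n+m 1 _)

-- With W = Σ g₁, k = W ∸ t₁, m = 2k + 1 and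
-- B beyond every g₂-sum, the weights B·(2g₁ + m·[z]) + g₂ and the threshold
-- B·2W + t₂ represent (z ∈ X and P X) or (V ⊆ X and Q X): the leading base-B
-- digit exceeds 2W iff z ∈ X and P X, and equals 2W iff z ∉ X and V ⊆ X.
module Gluing {n} (z : Fin n) (V : Subset n) {P Q : Subset n → Set}
  (g₁ : Fin n → ℕ) (t₁ : ℕ) (zero-off : ∀ i → i ∉ V → g₁ i ≡ 0) (positive : ∀ i → i ∈ V → 1 ≤ g₁ i)
  (rep₁ : ∀ X → t₁ ≤ wsum g₁ X ⇔ P X) (PV : P V)
  (g₂ : Fin n → ℕ) (t₂ : ℕ) (rep₂ : ∀ X → t₂ ≤ wsum g₂ X ⇔ Q X) where

  W k m B : ℕ
  W = sum g₁
  k = W ∸ t₁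
  m = suc (2 * k)
  B = suc (sum g₂ + t₂)

  w : Fin n → ℕ
  w i = B * (2 * g₁ i + point z m i) + g₂ i

  t₁+k≡W : t₁ + k ≡ W
  t₁+k≡W = ℕ.m+[n∸m]≡n (ℕ.≤-trans (from (rep₁ V) PV) (wsum≤sum g₁ V))

  t₂<B : t₂ < B
  t₂<B = s≤s (ℕ.m≤n+m t₂ (sum g₂))

  s<B : ∀ X → wsum g₂ X < B
  s<B X = s≤s (ℕ.≤-trans (wsum≤sum g₂ X) (ℕ.m≤m+n _ t₂))

  -- the leading base-B digit of wsum w X
  level : Subset n → ℕ
  level X = 2 * wsum g₁ X + restrict X (λ _ → m) z

  wsum-w : ∀ X → wsum w X ≡ B * level X + wsum g₂ X
  wsum-w X = trans (wsum-linear B _ g₂ X) (cong (λ l → B * l + wsum g₂ X)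
    (trans (wsum-linear 2 g₁ (point z m) X) (cong (2 * wsum g₁ X +_) (wsum-point z m X))))

  level-∈ : ∀ {X} → z ∈ X → level X ≡ 2 * wsum g₁ X + m
  level-∈ {X} z∈X = cong (2 * wsum g₁ X +_) (restrict-∈ (λ _ → m) z∈X)

  level-∉ : ∀ {X} → z ∉ X → level X ≡ 2 * wsum g₁ X
  level-∉ {X} z∉X = trans (cong (2 * wsum g₁ X +_) (restrict-∉ (λ _ → m) z∉X)) (ℕ.+-identityʳ _)

  high⇔ : ∀ X → 2 * W < level X ⇔ (z ∈ X × P X)
  high⇔ X with z ∈? X
  ... | yes z∈X = let odd = odd-above (wsum g₁ X) t₁+k≡W in mk⇔
    (λ above → z∈X , to (rep₁ X) (to odd (subst (2 * W <_) (level-∈ z∈X) above)))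
    (λ (_ , PX) → subst (2 * W <_) (sym (level-∈ z∈X)) (from odd (from (rep₁ X) PX)))
  ... | no  z∉X = mk⇔
    (λ above → ⊥-elim (ℕ.<⇒≱ above (subst (_≤ 2 * W) (sym (level-∉ z∉X)) (ℕ.*-monoʳ-≤ 2 (wsum≤sum g₁ X)))))
    (λ (z∈X , _) → ⊥-elim (z∉X z∈X))

  exact⇒ : ∀ X → level X ≡ 2 * W → V ⊆ X
  exact⇒ X level≡ with z ∈? X
  ... | yes z∈X = ⊥-elim (odd≢even {W} (wsum g₁ X) k (trans (sym (level-∈ z∈X)) level≡))
  ... | no  z∉X = Dec.decidable-stable (V ⊆? X) λ V⊈X →
    let (j , j∈V , j∉X) = ⊈⇒∃ V⊈X
    in ℕ.<-irrefl (ℕ.*-cancelˡ-≡ _ _ 2 (trans (sym (level-∉ z∉X)) level≡)) (wsum-missing g₁ X j j∉X (positive j j∈V))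

  exact⇐ : ∀ X → z ∉ X → V ⊆ X → level X ≡ 2 * W
  exact⇐ X z∉X V⊆X = trans (level-∉ z∉X) (cong (2 *_) (wsum-full g₁ X λ i i∉X → zero-off i (i∉X ∘ V⊆X)))

  Glued : Subset n → Set
  Glued X = (z ∈ X × P X) ⊎ (V ⊆ X × Q X)

  reached⇒glued : ∀ X → B * (2 * W) + t₂ ≤ B * level X + wsum g₂ X → Glued X
  reached⇒glued X reached with lex-≤⁻ B (s<B X) reached
  ... | inj₁ above           = inj₁ (to (high⇔ X) above)
  ... | inj₂ (exact , t₂≤)   = inj₂ (exact⇒ X (sym exact) , to (rep₂ X) t₂≤)

  glued⇒reached : ∀ X → Glued X → B * (2 * W) + t₂ ≤ B * level X + wsum g₂ X
  glued⇒reached X (inj₁ z∈X×PX)     = lex-≤⁺ B t₂<B (from (high⇔ X) z∈X×PX)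
  glued⇒reached X (inj₂ (V⊆X , QX)) with z ∈? X
  ... | yes z∈X = glued⇒reached X (inj₁ (z∈X , to (rep₁ X) (ℕ.≤-trans (from (rep₁ V) PV) (wsum-mono g₁ V⊆X))))
  ... | no  z∉X = subst (λ l → B * (2 * W) + t₂ ≤ B * l + wsum g₂ X) (sym (exact⇐ X z∉X V⊆X))
                    (ℕ.+-monoʳ-≤ (B * (2 * W)) (from (rep₂ X) QX))

  glued-threshold : IsThreshold Glued
  glued-threshold = w , B * (2 * W) + t₂ , λ X → mk⇔
    (reached⇒glued X ∘ subst (_ ≤_) (wsum-w X))
    (subst (_ ≤_) (sym (wsum-w X)) ∘ glued⇒reached X)

glue-threshold : ∀ {n} (z : Fin n) (V : Subset n) {P Q R : Subset n → Set} →
  PositiveThreshold V P → P V → IsThreshold Q →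
  (∀ X → ((z ∈ X × P X) ⊎ (V ⊆ X × Q X)) ⇔ R X) → IsThreshold R
glue-threshold z V (g₁ , t₁ , zero-off , positive , rep₁) PV (g₂ , t₂ , rep₂) glued⇔R =
  threshold-⇔ glued⇔R (Gluing.glued-threshold z V g₁ t₁ zero-off positive rep₁ PV g₂ t₂ rep₂)

module _ {n : ℕ} where

  DependentIn : List (Subset n) → Subset n → Set
  DependentIn E X = ∃ λ e → e ∈ₗ E × e ⊆ X

  OneSpernerList : List (Subset n) → Set
  OneSpernerList E = ∀ {e f} → e ∈ₗ E → f ∈ₗ E → e ≢ f → ∣ e ─ f ∣ ⊓ ∣ f ─ e ∣ ≡ 1

  ⊆⋃ : ∀ {e : Subset n} {E} → e ∈ₗ E → e ⊆ ⋃ E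
  ⊆⋃ (here refl) x∈e = x∈p∪q⁺ (inj₁ x∈e)
  ⊆⋃ (there e∈E) x∈e = x∈p∪q⁺ (inj₂ (⊆⋃ e∈E x∈e))

  ∈⋃⁻ : ∀ {x : Fin n} E → x ∈ ⋃ E → ∃ λ e → e ∈ₗ E × x ∈ e
  ∈⋃⁻ []      x∈ = ⊥-elim (∉⊥ x∈)
  ∈⋃⁻ (e ∷ E) x∈ with x∈p∪q⁻ e (⋃ E) x∈
  ... | inj₁ x∈e = e , here refl , x∈e
  ... | inj₂ x∈⋃ = let (f , f∈E , x∈f) = ∈⋃⁻ E x∈⋃ in f , there f∈E , x∈f

  ─-cancel : ∀ {p q r : Subset n} → r ⊆ q → (p ─ r) ─ (q ─ r) ≡ p ─ q
  ─-cancel {q = q} {r} r⊆q = ⊆-antisym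
    (λ x∈ → let (x∈p─r , x∉q─r) = to x∈p─q⇔ x∈ ; (x∈p , x∉r) = to x∈p─q⇔ x∈p─r
            in from x∈p─q⇔ (x∈p , λ x∈q → x∉q─r (from x∈p─q⇔ (x∈q , x∉r))))
    (λ x∈ → let (x∈p , x∉q) = to x∈p─q⇔ x∈
            in from x∈p─q⇔ (from x∈p─q⇔ (x∈p , x∉q ∘ r⊆q) , x∉q ∘ p─q⊆p q r))

  ─-⊆ : ∀ {p r X : Subset n} → p ─ r ⊆ X → r ⊆ X → p ⊆ X
  ─-⊆ {r = r} p─r⊆X r⊆X {x} x∈p with x ∈? r
  ... | yes x∈r = r⊆X x∈r
  ... | no  x∉r = p─r⊆X (x∈p∧x∉q⇒x∈p─q x∈p x∉r)

  trim : Subset n → {P : Subset n → Set} → Decidable P → List (Subset n) → List (Subset n)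
  trim r P? E = map (_─ r) (filter P? E)

  module _ {r : Subset n} {P : Subset n → Set} (P? : Decidable P) {E : List (Subset n)} where

    ∈trim⁻ : ∀ {e'} → e' ∈ₗ trim r P? E → ∃ λ e → e ∈ₗ E × P e × e' ≡ e ─ r
    ∈trim⁻ e'∈ = let (e , e∈E , e'≡ , Pe) = ∈-map∘filter⁻ (_─ r) P? e'∈ in e , e∈E , Pe , e'≡

    ∈trim⁺ : ∀ {e} → e ∈ₗ E → P e → e ─ r ∈ₗ trim r P? E
    ∈trim⁺ {e} e∈E Pe = ∈-map∘filter⁺ (_─ r) P? (e , e∈E , refl , Pe)

    trim-1-Sperner : OneSpernerList E → (∀ {e} → e ∈ₗ E → P e → r ⊆ e) → OneSpernerList (trim r P? E)
    trim-1-Sperner sperner r⊆ e'∈ f'∈ e'≢f' with ∈trim⁻ e'∈ | ∈trim⁻ f'∈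
    ... | e , e∈E , Pe , refl | f , f∈E , Pf , refl =
      trans (cong₂ (λ a b → ∣ a ∣ ⊓ ∣ b ∣) (─-cancel {e} (r⊆ f∈E Pf)) (─-cancel {f} (r⊆ e∈E Pe)))
            (sperner e∈E f∈E (e'≢f' ∘ cong (_─ r)))

    trim-shrinks : ∀ {z} → z ∈ ⋃ E → (∀ {e} → e ∈ₗ E → P e → z ∉ e ─ r) → ⋃ (trim r P? E) ⊂ ⋃ E
    trim-shrinks {z} z∈⋃E z-gone = ⊆⋃E , z , z∈⋃E , z∉⋃trim
      where
      ⊆⋃E : ⋃ (trim r P? E) ⊆ ⋃ E
      ⊆⋃E x∈ =
        let (e' , e'∈ , x∈e') = ∈⋃⁻ (trim r P? E) x∈
            (e , e∈E , _ , e'≡) = ∈trim⁻ e'∈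
        in ⊆⋃ e∈E (p─q⊆p e r (subst (_ ∈_) e'≡ x∈e'))
      z∉⋃trim : z ∉ ⋃ (trim r P? E)
      z∉⋃trim z∈ =
        let (e' , e'∈ , z∈e') = ∈⋃⁻ (trim r P? E) z∈
            (e , e∈E , Pe , e'≡) = ∈trim⁻ e'∈
        in z-gone e∈E Pe (subst (z ∈_) e'≡ z∈e')

module Splitting {n : ℕ} (E : List (Subset n)) (sperner : OneSpernerList E) where

  Splits : Fin n → Set
  Splits z = ∀ {e f} → e ∈ₗ E → f ∈ₗ E → z ∈ e → z ∉ f → e - z ⊆ f

  private-nonempty : ∀ {e f} → e ∈ₗ E → f ∈ₗ E → e ≢ f → Nonempty (e ─ f)
  private-nonempty {e} {f} e∈E f∈E e≢f =
    1≤∣p∣⇒nonempty (e ─ f) (subst (_≤ ∣ e ─ f ∣) (sperner e∈E f∈E e≢f) (ℕ.m⊓n≤m _ _))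

  private-unique : ∀ {e f} → e ∈ₗ E → f ∈ₗ E → e ≢ f → ∣ e ∣ ≤ ∣ f ∣ → ∣ e ─ f ∣ ≤ 1
  private-unique {e} {f} e∈E f∈E e≢f ∣e∣≤∣f∣ = ℕ.≤-reflexive (trans
    (sym (ℕ.m≤n⇒m⊓n≡m (∣p∣≤∣q∣⇒∣p─q∣≤∣q─p∣ e f ∣e∣≤∣f∣))) (sperner e∈E f∈E e≢f))

  smaller⇒covered : ∀ {e f z} → e ∈ₗ E → f ∈ₗ E → ∣ e ∣ ≤ ∣ f ∣ → z ∈ e → z ∉ f → e - z ⊆ f
  smaller⇒covered {e} {f} {z} e∈E f∈E ∣e∣≤∣f∣ z∈e z∉f {c} c∈e-z =
    Dec.decidable-stable (c ∈? f) λ c∉f → c≢z (∣p∣≤1⇒unique (private-unique e∈E f∈E e≢f ∣e∣≤∣f∣)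
      (x∈p∧x∉q⇒x∈p─q c∈e c∉f) (x∈p∧x∉q⇒x∈p─q z∈e z∉f))
    where
    e≢f : e ≢ f
    e≢f refl = z∉f z∈e
    c∈e = to x∈p─q⇔ c∈e-z .proj₁
    c≢z = x∉⁅y⁆⇒x≢y (to x∈p─q⇔ c∈e-z .proj₂)

  -- If some edge f avoiding z is smaller than an edge e through z, covering
  -- still holds, provided e₀ - z ⊆ f, e₀ - z ⊆ f* and e - z ⊆ f* for edges
  -- e₀ ∋ z and f* ∌ z: a vertex of e - z outside f would produce two
  -- different private vertices of f over e.
  larger⇒covered : ∀ {e₀ f* z e f} → e₀ ∈ₗ E → f* ∈ₗ E → e ∈ₗ E → f ∈ₗ E →
    e₀ - z ⊆ f → e₀ - z ⊆ f* → e - z ⊆ f* → ∣ f ∣ ≤ ∣ e ∣ → z ∈ e → z ∉ f → e - z ⊆ f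
  larger⇒covered {e₀} {f*} {z} {e} {f} e₀∈E f*∈E e∈E f∈E e₀⊆f e₀⊆f* e⊆f* ∣f∣≤∣e∣ z∈e z∉f {c} c∈e-z
    with ≡-dec _≟ᵇ_ e e₀
  ... | yes refl = e₀⊆f c∈e-z
  ... | no  e≢e₀ = Dec.decidable-stable (c ∈? f) λ c∉f →
    let -- a private vertex c₁ of e₀ over e; it lies in f
        (c₁ , c₁∈e₀─e)   = private-nonempty e₀∈E e∈E (e≢e₀ ∘ sym)
        (c₁∈e₀ , c₁∉e)   = to x∈p─q⇔ c₁∈e₀─e
        c₁∈e₀-z          = x∈p∧x≢y⇒x∈p-y c₁∈e₀ λ c₁≡z → c₁∉e (subst (_∈ e) (sym c₁≡z) z∈e)
        -- a private vertex d of f over f*; it is not in e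
        (d , d∈f─f*)     = private-nonempty f∈E f*∈E λ f≡f* → c∉f (subst (c ∈_) (sym f≡f*) (e⊆f* c∈e-z))
        (d∈f , d∉f*)     = to x∈p─q⇔ d∈f─f*
        d∉e              = λ d∈e → d∉f* (e⊆f* (x∈p∧x≢y⇒x∈p-y d∈e λ d≡z → z∉f (subst (_∈ f) d≡z d∈f)))
        -- both are private vertices of f over e, hence equal
        c₁≡d = ∣p∣≤1⇒unique (private-unique f∈E e∈E (λ f≡e → z∉f (subst (z ∈_) (sym f≡e) z∈e)) ∣f∣≤∣e∣)
                 (x∈p∧x∉q⇒x∈p─q (e₀⊆f c₁∈e₀-z) c₁∉e) (x∈p∧x∉q⇒x∈p─q d∈f d∉e)
    in d∉f* (subst (_∈ f*) c₁≡d (e₀⊆f* c₁∈e₀-z))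

  smallest : ∀ {e} → e ∈ₗ E → ∃ λ a → a ∈ₗ E × (∀ {b} → b ∈ₗ E → ∣ a ∣ ≤ ∣ b ∣)
  smallest {e} e∈E = argmin ∣_∣ e E ,
    [ (λ a≡e → subst (_∈ₗ E) (sym a≡e) e∈E) , id ]′ (argmin-sel ∣_∣ e E) ,
    All.lookup (f[argmin]≤f[xs] {f = ∣_∣} e E)

  largest : ∀ {e} → e ∈ₗ E → ∃ λ a → a ∈ₗ E × (∀ {b} → b ∈ₗ E → ∣ b ∣ ≤ ∣ a ∣)
  largest {e} e∈E = argmax ∣_∣ e E ,
    [ (λ a≡e → subst (_∈ₗ E) (sym a≡e) e∈E) , id ]′ (argmax-sel ∣_∣ e E) ,
    All.lookup (f[xs]≤f[argmax] {f = ∣_∣} e E)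

  splits-from : ∀ {e₀ f* z} → e₀ ∈ₗ E → (∀ {b} → b ∈ₗ E → ∣ e₀ ∣ ≤ ∣ b ∣) →
    f* ∈ₗ E → (∀ {b} → b ∈ₗ E → ∣ b ∣ ≤ ∣ f* ∣) → z ∈ e₀ → z ∉ f* ⊎ ∣ f* ∣ ≤ ∣ e₀ ∣ → Splits z
  splits-from e₀∈E e₀-min f*∈E f*-max z∈e₀ outside {e} {f} e∈E f∈E z∈e z∉f with ∣ e ∣ ≤? ∣ f ∣
  ... | yes ∣e∣≤∣f∣ = smaller⇒covered e∈E f∈E ∣e∣≤∣f∣ z∈e z∉f
  ... | no  ∣e∣≰∣f∣ =
    let z∉f* = [ id , (λ ∣f*∣≤∣e₀∣ → ⊥-elim (∣e∣≰∣f∣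
                 (ℕ.≤-trans (f*-max e∈E) (ℕ.≤-trans ∣f*∣≤∣e₀∣ (e₀-min f∈E))))) ]′ outside
    in larger⇒covered e₀∈E f*∈E e∈E f∈E
         (smaller⇒covered e₀∈E f∈E (e₀-min f∈E) z∈e₀ z∉f)
         (smaller⇒covered e₀∈E f*∈E (e₀-min f*∈E) z∈e₀ z∉f*)
         (smaller⇒covered e∈E f*∈E (f*-max e∈E) z∈e z∉f*)
         (ℕ.<⇒≤ (ℕ.≰⇒> ∣e∣≰∣f∣)) z∈e z∉f

  splitting-vertex : ∀ {e} → e ∈ₗ E → (∀ {e} → e ∈ₗ E → Nonempty e) →
    ∃ λ z → (∃ λ e₀ → e₀ ∈ₗ E × z ∈ e₀) × Splits z
  splitting-vertex e∈E nonempty =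
    let (e₀ , e₀∈E , e₀-min) = smallest e∈E
        (f* , f*∈E , f*-max) = largest e∈E
        (z , z∈e₀ , outside) = choose e₀∈E f*∈E
    in z , (e₀ , e₀∈E , z∈e₀) , splits-from e₀∈E e₀-min f*∈E f*-max z∈e₀ outside
    where
    choose : ∀ {e₀ f*} → e₀ ∈ₗ E → f* ∈ₗ E → ∃ λ z → z ∈ e₀ × (z ∉ f* ⊎ ∣ f* ∣ ≤ ∣ e₀ ∣)
    choose {e₀} {f*} e₀∈E f*∈E with nonempty? (e₀ ─ f*)
    ... | yes (z , z∈e₀─f*) = z , to x∈p─q⇔ z∈e₀─f* .proj₁ , inj₁ (to x∈p─q⇔ z∈e₀─f* .proj₂)
    ... | no  no-private    =
      let e₀≡f* = Dec.decidable-stable (≡-dec _≟ᵇ_ e₀ f*) (no-private ∘ private-nonempty e₀∈E f*∈E)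
          (z , z∈e₀) = nonempty e₀∈E
      in z , z∈e₀ , inj₂ (ℕ.≤-reflexive (cong ∣_∣ (sym e₀≡f*)))

module Decomposition {n : ℕ} (E : List (Subset n)) (sperner : OneSpernerList E)
                     (z : Fin n) (splits : Splitting.Splits E sperner z) where

  through? : Decidable (z ∈_)
  through? e = z ∈? e

  avoiding? : Decidable (z ∉_)
  avoiding? e = Dec.¬? (z ∈? e)

  E₁ : List (Subset n)
  E₁ = trim ⁅ z ⁆ through? E

  V : Subset n
  V = ⋃ E₁

  E₂ : List (Subset n)
  E₂ = trim V avoiding? E

  ⁅z⁆⊆ : ∀ {e} → z ∈ e → ⁅ z ⁆ ⊆ e
  ⁅z⁆⊆ z∈e x∈⁅z⁆ = subst (_∈ _) (sym (x∈⁅y⁆⇒x≡y _ x∈⁅z⁆)) z∈e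

  V⊆ : ∀ {f} → f ∈ₗ E → z ∉ f → V ⊆ f
  V⊆ f∈E z∉f x∈V =
    let (e' , e'∈E₁ , x∈e') = ∈⋃⁻ E₁ x∈V
        (e , e∈E , z∈e , e'≡) = ∈trim⁻ through? e'∈E₁
    in splits e∈E f∈E z∈e z∉f (subst (_ ∈_) e'≡ x∈e')

  decomposition : ∀ X → ((z ∈ X × DependentIn E₁ X) ⊎ (V ⊆ X × DependentIn E₂ X)) ⇔ DependentIn E X
  decomposition X = mk⇔ join split
    where
    split : DependentIn E X → (z ∈ X × DependentIn E₁ X) ⊎ (V ⊆ X × DependentIn E₂ X)
    split (e , e∈E , e⊆X) with z ∈? e
    ... | yes z∈e = inj₁ (e⊆X z∈e , e - z , ∈trim⁺ through? e∈E z∈e , ⊆-trans (p─q⊆p e _) e⊆X)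
    ... | no  z∉e = inj₂ (⊆-trans (V⊆ e∈E z∉e) e⊆X , e ─ V , ∈trim⁺ avoiding? e∈E z∉e , ⊆-trans (p─q⊆p e V) e⊆X)
    join : (z ∈ X × DependentIn E₁ X) ⊎ (V ⊆ X × DependentIn E₂ X) → DependentIn E X
    join (inj₁ (z∈X , e' , e'∈E₁ , e'⊆X)) =
      let (e , e∈E , _ , e'≡) = ∈trim⁻ through? e'∈E₁
      in e , e∈E , ─-⊆ (subst (_⊆ X) e'≡ e'⊆X) (⁅z⁆⊆ z∈X)
    join (inj₂ (V⊆X , f' , f'∈E₂ , f'⊆X)) =
      let (f , f∈E , _ , f'≡) = ∈trim⁻ avoiding? f'∈E₂
      in f , f∈E , ─-⊆ (subst (_⊆ X) f'≡ f'⊆X) V⊆X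

  E₁-1-Sperner : OneSpernerList E₁
  E₁-1-Sperner = trim-1-Sperner through? sperner λ _ → ⁅z⁆⊆

  E₂-1-Sperner : OneSpernerList E₂
  E₂-1-Sperner = trim-1-Sperner avoiding? sperner V⊆

  E₁-shrinks : z ∈ ⋃ E → ⋃ E₁ ⊂ ⋃ E
  E₁-shrinks z∈⋃E = trim-shrinks through? {E} z∈⋃E λ _ _ z∈e-z → x∉⁅y⁆⇒x≢y (to x∈p─q⇔ z∈e-z .proj₂) refl

  E₂-shrinks : z ∈ ⋃ E → ⋃ E₂ ⊂ ⋃ E
  E₂-shrinks z∈⋃E = trim-shrinks avoiding? {E} z∈⋃E λ _ z∉e z∈e─V → z∉e (p─q⊆p _ V z∈e─V)

  E₁-local : ∀ X → DependentIn E₁ X ⇔ DependentIn E₁ (X ∩ V)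
  E₁-local X = mk⇔
    (λ (e , e∈E₁ , e⊆X) → e , e∈E₁ , λ x∈e → x∈p∩q⁺ (e⊆X x∈e , ⊆⋃ e∈E₁ x∈e))
    (λ (e , e∈E₁ , e⊆X∩V) → e , e∈E₁ , λ x∈e → x∈p∩q⁻ X V (e⊆X∩V x∈e) .proj₁)

  E₁-V : ∀ {e₀} → e₀ ∈ₗ E → z ∈ e₀ → DependentIn E₁ V
  E₁-V e₀∈E z∈e₀ = let e₀-z∈E₁ = ∈trim⁺ through? e₀∈E z∈e₀ in _ , e₀-z∈E₁ , ⊆⋃ e₀-z∈E₁

no-edges-threshold : ∀ {n} → IsThreshold (DependentIn {n} [])
no-edges-threshold {n} = (λ _ → 0) , 1 , λ X → mk⇔
  (λ 1≤w → ⊥-elim (ℕ.<⇒≱ 1≤w (ℕ.≤-trans (wsum≤sum (λ _ → 0) X) (ℕ.≤-reflexive (sum-replicate-zero n)))))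
  (λ { (_ , () , _) })

empty-edge-threshold : ∀ {n} {E : List (Subset n)} {e} → e ∈ₗ E → ¬ Nonempty e → IsThreshold (DependentIn E)
empty-edge-threshold e∈E empty = (λ _ → 0) , 0 , λ X → mk⇔
  (λ _ → _ , e∈E , λ {x} x∈e → ⊥-elim (empty (x , x∈e)))
  (λ _ → z≤n)

threshold-step : ∀ {n} (E : List (Subset n)) → OneSpernerList E → ∀ {e} → e ∈ₗ E →
  (∀ {e} → e ∈ₗ E → Nonempty e) →
  (∀ {E'} → ⋃ E' ⊂ ⋃ E → OneSpernerList E' → IsThreshold (DependentIn E')) →
  IsThreshold (DependentIn E)
threshold-step E sperner e∈E nonempty smaller-threshold =
  let (z , (e₀ , e₀∈E , z∈e₀) , splits) = Splitting.splitting-vertex E sperner e∈E nonempty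
      open Decomposition E sperner z splits
      z∈⋃E = ⊆⋃ e₀∈E z∈e₀
  in glue-threshold z V
       (positive-threshold V E₁-local (smaller-threshold (E₁-shrinks z∈⋃E) E₁-1-Sperner))
       (E₁-V e₀∈E z∈e₀)
       (smaller-threshold (E₂-shrinks z∈⋃E) E₂-1-Sperner)
       decomposition

1-Sperner⇒threshold : ∀ {n} (E : List (Subset n)) → OneSpernerList E → IsThreshold (DependentIn E)
1-Sperner⇒threshold E = induct E (⊂-wellFounded (⋃ E))
  where
  induct : ∀ {n} (E : List (Subset n)) → Acc _⊂_ (⋃ E) → OneSpernerList E → IsThreshold (DependentIn E)
  induct []          _             _       = no-edges-threshold
  induct E@(_ ∷ _)   (acc smaller) sperner with Any.any? (Dec.¬? ∘ nonempty?) E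
  ... | yes has-empty = let (_ , e∈E , empty) = find has-empty in empty-edge-threshold e∈E empty
  ... | no  no-empty  = threshold-step E sperner (here refl)
    (λ e∈E → Dec.decidable-stable (nonempty? _) (no-empty ∘ lose e∈E))
    (λ ⋃E'⊂⋃E → induct _ (smaller ⋃E'⊂⋃E))

listed-1-Sperner⇒threshold : ∀ {n} (H : Hypergraph n) (E : List (Subset n)) →
  (∀ e → Edge H e ⇔ e ∈ₗ E) → OneSperner H → Threshold H
listed-1-Sperner⇒threshold H E listed sperner = threshold-⇔ dependent⇔
  (1-Sperner⇒threshold E λ e∈E f∈E → sperner _ _ (from (listed _) e∈E) (from (listed _) f∈E))
  where
  dependent⇔ : ∀ X → DependentIn E X ⇔ Dependent H X
  dependent⇔ X = mk⇔ (λ (e , e∈E , e⊆X) → e , from (listed e) e∈E , e⊆X)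
                     (λ (e , edge , e⊆X) → e , to (listed e) edge , e⊆X)

dependent-mono : ∀ {n} (H : Hypergraph n) {X Y} → X ⊆ Y → Dependent H X → Dependent H Y
dependent-mono H X⊆Y (e , edge , e⊆X) = e , edge , ⊆-trans e⊆X X⊆Y

module ClosedNeighbourhoods {n : ℕ} (G : Graph n) where

  N : Fin n → Subset n
  N v = N[ v ] G

  ∈N⁻ : ∀ {u v} → u ∈ N v → u ≡ v ⊎ adj G v u ≡ true
  ∈N⁻ {u} {v} u∈Nv with u ≟ v | trans (sym (lookup∘tabulate _ u)) ([]=⇒lookup u∈Nv)
  ... | yes u≡v | _      = inj₁ u≡v
  ... | no  _   | adj≡true = inj₂ adj≡true

  ∈N⁺ : ∀ {u v} → u ≡ v ⊎ adj G v u ≡ true → u ∈ N v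
  ∈N⁺ {u} {v} u∼v = lookup⇒[]= u (N v) (trans (lookup∘tabulate _ u) (closed u∼v))
    where
    closed : u ≡ v ⊎ adj G v u ≡ true → (does (u ≟ v) ∨ adj G v u) ≡ true
    closed u∼v       with u ≟ v
    closed _         | yes _   = refl
    closed (inj₁ u≡v) | no u≢v = ⊥-elim (u≢v u≡v)
    closed (inj₂ adj) | no _   = adj

  v∈N[v] : ∀ v → v ∈ N v
  v∈N[v] v = ∈N⁺ (inj₁ refl)

  ∈N-sym : ∀ {u v} → u ∈ N v → v ∈ N u
  ∈N-sym u∈Nv with ∈N⁻ u∈Nv
  ... | inj₁ refl = v∈N[v] _
  ... | inj₂ adj  = ∈N⁺ (inj₂ (trans (Graph.sym G _ _) adj))

  H : Hypergraph n
  H = ClosedNbhdHypergraph G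

  IsMinimal : Fin n → Set
  IsMinimal v = ∀ u → ¬ (N u ⊂ N v)

  minimal-below : ∀ v → ∃ λ m → IsMinimal m × N m ⊆ N v
  minimal-below v = descend v (⊂-wellFounded (N v))
    where
    descend : ∀ v → Acc _⊂_ (N v) → ∃ λ m → IsMinimal m × N m ⊆ N v
    descend v (acc smaller) with Fin.any? (λ u → N u ⊂? N v)
    ... | no  none          = v , (λ u Nu⊂Nv → none (u , Nu⊂Nv)) , id
    ... | yes (u , Nu⊂Nv) with descend u (smaller Nu⊂Nv)
    ...   | m , minimal , Nm⊆Nu = m , minimal , ⊆-trans Nm⊆Nu (p⊂q⇒p⊆q Nu⊂Nv)

  dependent⇔∃N⊆ : ∀ X → Dependent H X ⇔ (∃ λ v → N v ⊆ X)
  dependent⇔∃N⊆ X = mk⇔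
    (λ { (_ , ((v , refl) , _) , Nv⊆X) → v , Nv⊆X })
    (λ { (v , Nv⊆X) → let (m , minimal , Nm⊆Nv) = minimal-below v
                      in N m , ((m , refl) , minimal) , ⊆-trans Nm⊆Nv Nv⊆X })

  dependent? : ∀ X → Dec (Dependent H X)
  dependent? X = Dec.map′ (from (dependent⇔∃N⊆ X)) (to (dependent⇔∃N⊆ X)) (Fin.any? (λ v → N v ⊆? X))

  dominated⇔meets : ∀ D v →
    (v ∈ D ⊎ ∃ (λ u → adj G v u ≡ true × u ∈ D)) ⇔ (∃ λ u → u ∈ N v × u ∈ D)
  dominated⇔meets D v = mk⇔
    (λ { (inj₁ v∈D) → v , v∈N[v] v , v∈D ; (inj₂ (u , adj , u∈D)) → u , ∈N⁺ (inj₂ adj) , u∈D })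
    (λ { (u , u∈Nv , u∈D) → case u∈Nv u∈D })
    where
    case : ∀ {u} → u ∈ N v → u ∈ D → v ∈ D ⊎ ∃ (λ u → adj G v u ≡ true × u ∈ D)
    case {u} u∈Nv u∈D with ∈N⁻ u∈Nv
    ... | inj₁ refl = inj₁ u∈D
    ... | inj₂ adj  = inj₂ (u , adj , u∈D)

  dominating⇔independent-complement : ∀ X → Dominating G X ⇔ (¬ Dependent H (∁ X))
  dominating⇔independent-complement X = mk⇔
    (λ dom dep → let (v , Nv⊆∁X) = to (dependent⇔∃N⊆ (∁ X)) dep
                     (u , u∈Nv , u∈X) = to (dominated⇔meets X v) (dom v)
                 in x∈∁p⇒x∉p (Nv⊆∁X u∈Nv) u∈X)
    (λ indep v → from (dominated⇔meets X v) (meets indep v))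
    where
    meets : ¬ Dependent H (∁ X) → ∀ v → ∃ λ u → u ∈ N v × u ∈ X
    meets indep v with Fin.any? (λ u → (u ∈? N v) ×-dec (u ∈? X))
    ... | yes found = found
    ... | no  none  = ⊥-elim (indep (from (dependent⇔∃N⊆ (∁ X)) (v , Nv⊆∁X)))
      where
      Nv⊆∁X : N v ⊆ ∁ X
      Nv⊆∁X {u} u∈Nv = x∉p⇒x∈∁p λ u∈X → none (u , u∈Nv , u∈X)

  dependent⇔non-dominating-complement : ∀ Y → Dependent H Y ⇔ (¬ Dominating G (∁ Y))
  dependent⇔non-dominating-complement Y = mk⇔
    (λ dep dom → to (dominating⇔independent-complement (∁ Y)) dom (dependent-mono H ∁∁-intro dep))
    (λ not-dom → Dec.decidable-stable (dependent? Y) λ indep →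
       not-dom (from (dominating⇔independent-complement (∁ Y)) (indep ∘ dependent-mono H ∁∁-elim)))
    where
    ∁∁-intro : Y ⊆ ∁ (∁ Y)
    ∁∁-intro = x∉p⇒x∈∁p ∘ x∈p⇒x∉∁p
    ∁∁-elim : ∁ (∁ Y) ⊆ Y
    ∁∁-elim = x∉∁p⇒x∈p ∘ x∈∁p⇒x∉p

  minimal? : ∀ v → Dec (IsMinimal v)
  minimal? v = Fin.all? (λ u → Dec.¬? (N u ⊂? N v))

  minimal-nbhds : List (Subset n)
  minimal-nbhds = map N (filter minimal? (allFin n))

  edges-listed : ∀ e → Edge H e ⇔ e ∈ₗ minimal-nbhds
  edges-listed _ = mk⇔ listed unlisted
    where
    listed : ∀ {e} → Edge H e → e ∈ₗ minimal-nbhds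
    listed ((v , refl) , minimal) = ∈-map∘filter⁺ N minimal? (v , ∈-allFin v , refl , minimal)
    unlisted : ∀ {e} → e ∈ₗ minimal-nbhds → Edge H e
    unlisted e∈ with ∈-map∘filter⁻ N minimal? {xs = allFin n} e∈
    ... | v , _ , refl , minimal = (v , refl) , minimal

domishold⇒threshold : ∀ {n} (G : Graph n) → Domishold G → Threshold (ClosedNbhdHypergraph G)
domishold⇒threshold G = threshold-dual (ClosedNeighbourhoods.dependent⇔non-dominating-complement G)

threshold⇒domishold : ∀ {n} (G : Graph n) → Threshold (ClosedNbhdHypergraph G) → Domishold G
threshold⇒domishold G = threshold-dual (ClosedNeighbourhoods.dominating⇔independent-complement G)

neighbourhood-1-Sperner⇒threshold : ∀ {n} (G : Graph n) →
  OneSperner (ClosedNbhdHypergraph G) → Threshold (ClosedNbhdHypergraph G)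
neighbourhood-1-Sperner⇒threshold G =
  listed-1-Sperner⇒threshold _ _ (ClosedNeighbourhoods.edges-listed G)

module AsummableNeighbourhoods {n : ℕ} (G : Graph n) (asummable : TwoAsummable (ClosedNbhdHypergraph G)) where
  open ClosedNeighbourhoods G

  NbhdFree : Subset n → Set
  NbhdFree S = ∀ z → ¬ (N z ⊆ S)

  Private : Fin n → Fin n → Fin n → Set
  Private u v x = x ∈ N u × x ∉ N v

  -- Exchanging private neighbours between N[u] and N[v] cannot make both sets
  -- independent: the exchange keeps χ N[u] + χ N[v].
  exchange : ∀ {u v x y} → Private u v x → Private v u y →
    NbhdFree (swap (N u) x y) → NbhdFree (swap (N v) y x) → ⊥
  exchange {u} {v} (x∈Nu , x∉Nv) (y∈Nv , y∉Nu) free₁ free₂ = asummable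
    (swap (N u) _ _ , swap (N v) _ _ , N u , N v , independent free₁ , independent free₂ ,
     nbhd-dependent u , nbhd-dependent v , χ-swap x∈Nu x∉Nv y∈Nv y∉Nu)
    where
    independent : ∀ {S} → NbhdFree S → Independent H S
    independent {S} free dep = let (z , Nz⊆S) = to (dependent⇔∃N⊆ S) dep in free z Nz⊆S
    nbhd-dependent : ∀ w → Dependent H (N w)
    nbhd-dependent w = from (dependent⇔∃N⊆ (N w)) (w , id)

  swap-non-adjacent-free : ∀ {a b b'} → a ∉ N b → Private b a b' → b' ≢ b → NbhdFree (swap (N a) a b)
  swap-non-adjacent-free {a} a∉Nb (b'∈Nb , b'∉Na) b'≢b z Nz⊆S with ∈swap⁻ {S = N a} (Nz⊆S (v∈N[v] z))
  ... | inj₁ (z∈Na , _) = x∉swap (v∈N[v] a) (a∉Nb ∘ ∈N-sym) (Nz⊆S (∈N-sym z∈Na))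
  ... | inj₂ refl       = [ b'∉Na ∘ proj₁ , b'≢b ]′ (∈swap⁻ {S = N a} (Nz⊆S b'∈Nb))

  non-adjacent⇒nested : ∀ {a b a' b'} → a ∉ N b →
    Private a b a' → a' ≢ a → Private b a b' → b' ≢ b → ⊥
  non-adjacent⇒nested {a} {b} a∉Nb a'-private a'≢a b'-private b'≢b = exchange
    (v∈N[v] a , a∉Nb) (v∈N[v] b , a∉Nb ∘ ∈N-sym)
    (swap-non-adjacent-free a∉Nb b'-private b'≢b)
    (swap-non-adjacent-free (a∉Nb ∘ ∈N-sym) a'-private a'≢a)

  Complete : Fin n → Fin n → Set
  Complete u v = ∀ {x y} → Private u v x → Private v u y → y ∈ N x

  -- A closed neighbourhood N[w] inside the exchanged set would make w and x
  -- non-adjacent vertices with private neighbours other than themselves.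
  swap-adjacent-free : ∀ {u v x y y'} → IsMinimal u → v ∈ N u →
    Private u v x → Private v u y → Private v u y' → y' ≢ y →
    y ∉ N x ⊎ Complete u v → NbhdFree (swap (N u) x y)
  swap-adjacent-free {u} {v} {x} {y} {y'} minimal v∈Nu x-priv@(x∈Nu , x∉Nv) (y∈Nv , y∉Nu)
                     y'-priv@(y'∈Nv , y'∉Nu) y'≢y split w Nw⊆A =
    let (a' , a'-priv , a'≢w) = private-of-w
        (b' , b'-priv , b'≢x) = private-of-x split
    in non-adjacent⇒nested (x∉Nw ∘ ∈N-sym) a'-priv a'≢w b'-priv b'≢x
    where
    inside : ∀ {i} → i ∈ N w → (i ∈ N u × i ≢ x) ⊎ i ≡ y
    inside i∈Nw = ∈swap⁻ {S = N u} (Nw⊆A i∈Nw)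

    x∉Nw : x ∉ N w
    x∉Nw = x∉swap x∈Nu y∉Nu ∘ Nw⊆A

    y'∉Nw : y' ∉ N w
    y'∉Nw y'∈Nw = [ y'∉Nu ∘ proj₁ , y'≢y ]′ (inside y'∈Nw)

    v∉Nx : v ∉ N x
    v∉Nx = x∉Nv ∘ ∈N-sym

    -- N[w] ⊆ N[u] would be strict (x is missing), so y ∈ N[w] by minimality of u.
    y∈Nw : y ∈ N w
    y∈Nw = Dec.decidable-stable (y ∈? N w) λ y∉Nw →
      minimal w ((λ i∈Nw → [ proj₁ , (λ { refl → ⊥-elim (y∉Nw i∈Nw) }) ]′ (inside i∈Nw)) , x , x∈Nu , x∉Nw)

    private-of-w : ∃ λ a' → Private w x a' × a' ≢ w
    private-of-w with v ∈? N w
    ... | yes v∈Nw = v , (v∈Nw , v∉Nx) , λ { refl → y'∉Nw y'∈Nv }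
    ... | no  v∉Nw = by-cases split
      where
      y≢w : y ≢ w
      y≢w refl = v∉Nw (∈N-sym y∈Nv)
      w∈Nu : w ∈ N u
      w∈Nu = [ proj₁ , (λ w≡y → ⊥-elim (y≢w (sym w≡y))) ]′ (inside (v∈N[v] w))
      by-cases : y ∉ N x ⊎ Complete u v → ∃ λ a' → Private w x a' × a' ≢ w
      by-cases (inj₁ y∉Nx)    = y , (y∈Nw , y∉Nx) , y≢w
      by-cases (inj₂ complete) = ⊥-elim (y'∉Nw (complete (w∈Nu , v∉Nw ∘ ∈N-sym) y'-priv))

    private-of-x : y ∉ N x ⊎ Complete u v → ∃ λ b' → Private x w b' × b' ≢ x
    private-of-x (inj₂ complete) = y' , (complete x-priv y'-priv , y'∉Nw) , λ { refl → y'∉Nu x∈Nu }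
    -- otherwise take p ∈ N[x] ∖ N[u]: N[x] ⊆ N[u] would be strict (v is missing)
    private-of-x (inj₁ y∉Nx) with ⊈⇒∃ {p = N x} {N u} (λ Nx⊆Nu → minimal x (Nx⊆Nu , v , v∈Nu , v∉Nx))
    ... | p , p∈Nx , p∉Nu =
      p , (p∈Nx , λ p∈Nw → [ p∉Nu ∘ proj₁ , (λ { refl → y∉Nx p∈Nx }) ]′ (inside p∈Nw)) ,
      λ { refl → p∉Nu x∈Nu }

  private-avoiding : ∀ {a b} → 2 ≤ ∣ N a ─ N b ∣ → ∀ c → ∃ λ x → Private a b x × x ≢ c
  private-avoiding large c with 2≤∣p∣⇒avoid _ large c
  ... | x , x∈ , x≢c = x , to x∈p─q⇔ x∈ , x≢c

  both-large⇒⊥ : ∀ {u v} → IsMinimal u → IsMinimal v →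
    2 ≤ ∣ N u ─ N v ∣ → 2 ≤ ∣ N v ─ N u ∣ → ⊥
  both-large⇒⊥ {u} {v} min-u min-v large-u large-v with v ∈? N u
  ... | no  v∉Nu =
    let (a' , a'-priv , a'≢u) = private-avoiding large-u u
        (b' , b'-priv , b'≢v) = private-avoiding large-v v
    in non-adjacent⇒nested (v∉Nu ∘ ∈N-sym) a'-priv a'≢u b'-priv b'≢v
  ... | yes v∈Nu =
    let (x , y , x-priv , y-priv , split) = choose
        (x' , x'-priv , x'≢x) = private-avoiding large-u x
        (y' , y'-priv , y'≢y) = private-avoiding large-v y
    in exchange x-priv y-priv
         (swap-adjacent-free min-u v∈Nu x-priv y-priv y'-priv y'≢y split)
         (swap-adjacent-free min-v (∈N-sym v∈Nu) y-priv x-priv x'-priv x'≢x (flip split))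
    where
    private? : ∀ a b x → Dec (Private a b x)
    private? a b x = (x ∈? N a) ×-dec Dec.¬? (x ∈? N b)

    choose : ∃ λ x → ∃ λ y → Private u v x × Private v u y × (y ∉ N x ⊎ Complete u v)
    choose with Fin.any? (λ x → Fin.any? (λ y → private? u v x ×-dec private? v u y ×-dec Dec.¬? (y ∈? N x)))
    ... | yes (x , y , x-priv , y-priv , y∉Nx) = x , y , x-priv , y-priv , inj₁ y∉Nx
    ... | no  none =
      let (x , x-priv , _) = private-avoiding large-u u
          (y , y-priv , _) = private-avoiding large-v v
      in x , y , x-priv , y-priv , inj₂ λ {x} {y} x-priv y-priv →
           Dec.decidable-stable (y ∈? N x) λ y∉Nx → none (x , y , x-priv , y-priv , y∉Nx)

    flip : ∀ {x y} → y ∉ N x ⊎ Complete u v → x ∉ N y ⊎ Complete v u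
    flip (inj₁ y∉Nx)    = inj₁ (y∉Nx ∘ ∈N-sym)
    flip (inj₂ complete) = inj₂ λ x-priv y-priv → ∈N-sym (complete y-priv x-priv)

  minimal-private : ∀ {u v} → IsMinimal v → N u ≢ N v → 1 ≤ ∣ N u ─ N v ∣
  minimal-private {u} {v} min-v Nu≢Nv with N u ⊆? N v
  ... | no  Nu⊈Nv = let (x , x-priv) = ⊈⇒∃ Nu⊈Nv in ∈⇒1≤∣p∣ (from x∈p─q⇔ x-priv)
  ... | yes Nu⊆Nv = ⊥-elim (min-v u (Nu⊆Nv , ⊈⇒∃ λ Nv⊆Nu → Nu≢Nv (⊆-antisym Nu⊆Nv Nv⊆Nu)))

  2-asummable⇒1-Sperner : OneSperner H
  2-asummable⇒1-Sperner _ _ ((u , refl) , min-u) ((v , refl) , min-v) Nu≢Nv =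
    ℕ.≤-antisym at-most-one (ℕ.⊓-glb (minimal-private min-v Nu≢Nv) (minimal-private min-u (Nu≢Nv ∘ sym)))
    where
    at-most-one : ∣ N u ─ N v ∣ ⊓ ∣ N v ─ N u ∣ ≤ 1
    at-most-one with 2 ≤? ∣ N u ─ N v ∣ ⊓ ∣ N v ─ N u ∣
    ... | no  ≱2 = ℕ.≤-pred (ℕ.≰⇒> ≱2)
    ... | yes ≥2 = ⊥-elim (both-large⇒⊥ min-u min-v (ℕ.≤-trans ≥2 (ℕ.m⊓n≤m _ _)) (ℕ.≤-trans ≥2 (ℕ.m⊓n≤n _ _)))

neighbourhood-2-asummable⇒1-Sperner : ∀ {n} (G : Graph n) →
  TwoAsummable (ClosedNbhdHypergraph G) → OneSperner (ClosedNbhdHypergraph G)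
neighbourhood-2-asummable⇒1-Sperner G = AsummableNeighbourhoods.2-asummable⇒1-Sperner G

theorem3p6 : ∀ {n : ℕ} (G : Graph n) →
    (Domishold G ⇔ OneSperner (ClosedNbhdHypergraph G)) ×
    (Domishold G ⇔ Threshold (ClosedNbhdHypergraph G)) ×
    (Domishold G ⇔ TwoAsummable (ClosedNbhdHypergraph G))
theorem3p6 G =
  mk⇔ (4⇒2 ∘ 3⇒4 ∘ 1⇒3) (3⇒1 ∘ 2⇒3) ,
  mk⇔ 1⇒3 3⇒1 ,
  mk⇔ (3⇒4 ∘ 1⇒3) (3⇒1 ∘ 2⇒3 ∘ 4⇒2)
  where
  𝒩 = ClosedNbhdHypergraph G
  1⇒3 : Domishold G → Threshold 𝒩
  1⇒3 = domishold⇒threshold G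
  3⇒1 : Threshold 𝒩 → Domishold G
  3⇒1 = threshold⇒domishold G
  3⇒4 : Threshold 𝒩 → TwoAsummable 𝒩
  3⇒4 = threshold⇒2-asummable 𝒩
  4⇒2 : TwoAsummable 𝒩 → OneSperner 𝒩
  4⇒2 = neighbourhood-2-asummable⇒1-Sperner G
  2⇒3 : OneSperner 𝒩 → Threshold 𝒩
  2⇒3 = neighbourhood-1-Sperner⇒threshold G
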